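{- The category $\mathbf{OMLatGal}$ has finite dagger biproducts. Explicitly, for orthomodular lattices $X_1,X_2$, let $X_1\oplus X_2$ be the cartesian product $X_1\times X_2$ with componentwise order and orthocomplement, and let $\kappa_1\colon X_1\to X_1\oplus X_2$ be given by $(\kappa_1)_*(x)=(x^\perp,1)$ and $(\kappa_1)^*(x,y)=x^\perp$, and $\kappa_2$ symmetrically by $(\kappa_2)_*(y)=(1,y^\perp)$, $(\kappa_2)^*(x,y)=y^\perp$. Then $\kappa_1,\kappa_2$ are dagger monos, $\kappa_j^\dagger\circ\kappa_i$ is the zero morphism for $i\ne j$, $(X_1\oplus X_2,\kappa_1,\kappa_2)$ is a coproduct, and $(X_1\oplus X_2,\pi_1,\pi_2)$ with $\pi_i=\kappa_i^\dagger$ is a product in $\mathbf{OMLatGal}$.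
   Context: An orthomodular lattice is a bounded lattice $X$ with an orthocomplement $x\mapsto x^\perp$ ($x^{\perp\perp}=x$, order-reversing, $x\wedge x^\perp=0$) such that $x\le y$ implies $y=x\vee(x^\perp\wedge y)$. $\mathbf{OMLatGal}$: objects orthomodular lattices; morphisms $f\colon X\to Y$ are pairs $(f_*,f^*)$ of order-reversing maps $f_*\colon X\to Y$, $f^*\colon Y\to X$ with $x\le f^*(y)\iff y\le f_*(x)$; identity $((-)^\perp,(-)^\perp)$; composition $(g\circ f)_*=g_*\circ(-)^\perp\circ f_*$, $(g\circ f)^*=f^*\circ(-)^\perp\circ g^*$; dagger $(f_*,f^*)^\dagger=(f^*,f_*)$; the zero morphism $X\to Y$ has $z_*(x)=1$, $z^*(y)=1$. A dagger mono is a morphism $k$ with $k^\dagger\circ k=\mathrm{id}$. -}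

module Defs where

open import Level using (Level; _⊔_) renaming (suc to lsuc)
open import Data.Product using (Σ; _×_; _,_; proj₁; proj₂)
open import Relation.Binary.Core using (Rel)
open import Relation.Binary.Structures using (IsPartialOrder; IsPreorder)
open import Relation.Binary.Lattice.Structures using (IsBoundedLattice; IsLattice)
open import Relation.Binary.PropositionalEquality
  using (_≡_; refl; cong₂; subst; isEquivalence)

record OML (c ℓ : Level) : Set (lsuc (c ⊔ ℓ)) where
  infix  4 _≤_
  infixr 6 _∨_
  infixr 7 _∧_
  infix  8 _ᗮ
  field
    Carrier          : Set c
    _≤_              : Rel Carrier ℓ
    _∨_ _∧_          : Carrier → Carrier → Carrier
    ⊤ ⊥              : Carrier
    isBoundedLattice : IsBoundedLattice _≡_ _≤_ _∨_ _∧_ ⊤ ⊥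
    _ᗮ               : Carrier → Carrier
    ᗮ-involutive     : ∀ x → (x ᗮ) ᗮ ≡ x
    ᗮ-antitone       : ∀ {x y} → x ≤ y → y ᗮ ≤ x ᗮ
    ᗮ-meet           : ∀ x → x ∧ x ᗮ ≡ ⊥
    orthomodular     : ∀ {x y} → x ≤ y → y ≡ x ∨ (x ᗮ ∧ y)

  open IsBoundedLattice isBoundedLattice public

  ᗮ-swapʳ : ∀ {x y} → x ≤ y ᗮ → y ≤ x ᗮ
  ᗮ-swapʳ {x} {y} p = subst (_≤ x ᗮ) (ᗮ-involutive y) (ᗮ-antitone p)

  ᗮ-swapˡ : ∀ {x y} → x ᗮ ≤ y → y ᗮ ≤ x
  ᗮ-swapˡ {x} {y} p = subst (y ᗮ ≤_) (ᗮ-involutive x) (ᗮ-antitone p)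

open OML using (Carrier)

module _ {c ℓ : Level} where

  record Hom (X Y : OML c ℓ) : Set (c ⊔ ℓ) where
    private
      module X = OML X
      module Y = OML Y
    field
      f₊ : X.Carrier → Y.Carrier
      f⁺ : Y.Carrier → X.Carrier
      f₊-antitone : ∀ {x x′} → x X.≤ x′ → f₊ x′ Y.≤ f₊ x
      f⁺-antitone : ∀ {y y′} → y Y.≤ y′ → f⁺ y′ X.≤ f⁺ y
      galois : ∀ x y → (x X.≤ f⁺ y → y Y.≤ f₊ x) × (y Y.≤ f₊ x → x X.≤ f⁺ y)

  open Hom public

  infix 4 _≈ₕ_
  _≈ₕ_ : ∀ {X Y} → Hom X Y → Hom X Y → Set c
  f ≈ₕ g = (∀ x → f₊ f x ≡ f₊ g x) × (∀ y → f⁺ f y ≡ f⁺ g y)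

  idₕ : ∀ {X} → Hom X X
  idₕ {X} = record
    { f₊ = _ᗮ ; f⁺ = _ᗮ
    ; f₊-antitone = ᗮ-antitone ; f⁺-antitone = ᗮ-antitone
    ; galois = λ x y → ᗮ-swapʳ , ᗮ-swapʳ }
    where open OML X

  infixr 9 _∘ₕ_
  _∘ₕ_ : ∀ {X Y Z} → Hom Y Z → Hom X Y → Hom X Z
  _∘ₕ_ {X} {Y} {Z} g f = record
    { f₊ = λ x → f₊ g (f₊ f x Y.ᗮ)
    ; f⁺ = λ z → f⁺ f (f⁺ g z Y.ᗮ)
    ; f₊-antitone = λ p → f₊-antitone g (Y.ᗮ-antitone (f₊-antitone f p))
    ; f⁺-antitone = λ p → f⁺-antitone f (Y.ᗮ-antitone (f⁺-antitone g p))
    ; galois = λ x z →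
        (λ p → proj₁ (galois g (f₊ f x Y.ᗮ) z)
                 (Y.ᗮ-swapˡ (proj₁ (galois f x (f⁺ g z Y.ᗮ)) p)))
      , (λ q → proj₂ (galois f x (f⁺ g z Y.ᗮ))
                 (Y.ᗮ-swapˡ (proj₂ (galois g (f₊ f x Y.ᗮ) z) q)))
    }
    where module Y = OML Y

  infix 10 _†
  _† : ∀ {X Y} → Hom X Y → Hom Y X
  f † = record
    { f₊ = f⁺ f ; f⁺ = f₊ f
    ; f₊-antitone = f⁺-antitone f ; f⁺-antitone = f₊-antitone f
    ; galois = λ y x → proj₂ (galois f x y) , proj₁ (galois f x y) }

  zeroₕ : ∀ {X Y} → Hom X Y
  zeroₕ {X} {Y} = record
    { f₊ = λ _ → Y.⊤ ; f⁺ = λ _ → X.⊤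
    ; f₊-antitone = λ _ → Y.maximum Y.⊤
    ; f⁺-antitone = λ _ → X.maximum X.⊤
    ; galois = λ x y → (λ _ → Y.maximum y) , (λ _ → X.maximum x) }
    where
      module X = OML X
      module Y = OML Y

  IsDaggerMono : ∀ {X Y} → Hom X Y → Set c
  IsDaggerMono k = k † ∘ₕ k ≈ₕ idₕ

  IsCoproduct : ∀ {X₁ X₂ P} → Hom X₁ P → Hom X₂ P → Set (lsuc (c ⊔ ℓ))
  IsCoproduct {X₁} {X₂} {P} i₁ i₂ =
    ∀ (Y : OML c ℓ) (f₁ : Hom X₁ Y) (f₂ : Hom X₂ Y) →
      Σ (Hom P Y) λ h →
        (h ∘ₕ i₁ ≈ₕ f₁) × (h ∘ₕ i₂ ≈ₕ f₂) ×
        (∀ (h′ : Hom P Y) → h′ ∘ₕ i₁ ≈ₕ f₁ → h′ ∘ₕ i₂ ≈ₕ f₂ → h′ ≈ₕ h)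

  IsProduct : ∀ {X₁ X₂ P} → Hom P X₁ → Hom P X₂ → Set (lsuc (c ⊔ ℓ))
  IsProduct {X₁} {X₂} {P} p₁ p₂ =
    ∀ (Y : OML c ℓ) (f₁ : Hom Y X₁) (f₂ : Hom Y X₂) →
      Σ (Hom Y P) λ h →
        (p₁ ∘ₕ h ≈ₕ f₁) × (p₂ ∘ₕ h ≈ₕ f₂) ×
        (∀ (h′ : Hom Y P) → p₁ ∘ₕ h′ ≈ₕ f₁ → p₂ ∘ₕ h′ ≈ₕ f₂ → h′ ≈ₕ h)

  infixr 5 _⊕_
  _⊕_ : OML c ℓ → OML c ℓ → OML c ℓ
  X₁ ⊕ X₂ = record
    { Carrier = A.Carrier × B.Carrier
    ; _≤_ = λ p q → (proj₁ p A.≤ proj₁ q) × (proj₂ p B.≤ proj₂ q)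
    ; _∨_ = λ p q → (proj₁ p A.∨ proj₁ q) , (proj₂ p B.∨ proj₂ q)
    ; _∧_ = λ p q → (proj₁ p A.∧ proj₁ q) , (proj₂ p B.∧ proj₂ q)
    ; ⊤ = A.⊤ , B.⊤
    ; ⊥ = A.⊥ , B.⊥
    ; isBoundedLattice = record
      { isLattice = record
        { isPartialOrder = record
          { isPreorder = record
            { isEquivalence = isEquivalence
            ; reflexive = λ { refl → A.refl , B.refl }
            ; trans = λ p q → A.trans (proj₁ p) (proj₁ q) , B.trans (proj₂ p) (proj₂ q)
            }
          ; antisym = λ p q → cong₂ _,_ (A.antisym (proj₁ p) (proj₁ q)) (B.antisym (proj₂ p) (proj₂ q))
          }
        ; supremum = λ { (a , b) (a′ , b′) →
            (A.x≤x∨y a a′ , B.x≤x∨y b b′) , (A.y≤x∨y a a′ , B.y≤x∨y b b′) ,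
            λ { _ p q → A.∨-least (proj₁ p) (proj₁ q) , B.∨-least (proj₂ p) (proj₂ q) } }
        ; infimum = λ { (a , b) (a′ , b′) →
            (A.x∧y≤x a a′ , B.x∧y≤x b b′) , (A.x∧y≤y a a′ , B.x∧y≤y b b′) ,
            λ { _ p q → A.∧-greatest (proj₁ p) (proj₁ q) , B.∧-greatest (proj₂ p) (proj₂ q) } }
        }
      ; maximum = λ { (a , b) → A.maximum a , B.maximum b }
      ; minimum = λ { (a , b) → A.minimum a , B.minimum b }
      }
    ; _ᗮ = λ p → (proj₁ p A.ᗮ) , (proj₂ p B.ᗮ)
    ; ᗮ-involutive = λ { (a , b) → cong₂ _,_ (A.ᗮ-involutive a) (B.ᗮ-involutive b) }
    ; ᗮ-antitone = λ p → A.ᗮ-antitone (proj₁ p) , B.ᗮ-antitone (proj₂ p)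
    ; ᗮ-meet = λ { (a , b) → cong₂ _,_ (A.ᗮ-meet a) (B.ᗮ-meet b) }
    ; orthomodular = λ p → cong₂ _,_ (A.orthomodular (proj₁ p)) (B.orthomodular (proj₂ p))
    }
    where
      module A = OML X₁
      module B = OML X₂

  κ₁ : ∀ {X₁ X₂} → Hom X₁ (X₁ ⊕ X₂)
  κ₁ {X₁} {X₂} = record
    { f₊ = λ x → (x A.ᗮ) , B.⊤
    ; f⁺ = λ p → proj₁ p A.ᗮ
    ; f₊-antitone = λ p → A.ᗮ-antitone p , B.refl
    ; f⁺-antitone = λ p → A.ᗮ-antitone (proj₁ p)
    ; galois = λ { x (a , b) → (λ p → A.ᗮ-swapʳ p , B.maximum b)
                             , (λ q → A.ᗮ-swapʳ (proj₁ q)) }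
    }
    where
      module A = OML X₁
      module B = OML X₂

  κ₂ : ∀ {X₁ X₂} → Hom X₂ (X₁ ⊕ X₂)
  κ₂ {X₁} {X₂} = record
    { f₊ = λ y → A.⊤ , (y B.ᗮ)
    ; f⁺ = λ p → proj₂ p B.ᗮ
    ; f₊-antitone = λ p → A.refl , B.ᗮ-antitone p
    ; f⁺-antitone = λ p → B.ᗮ-antitone (proj₂ p)
    ; galois = λ { y (a , b) → (λ p → A.maximum a , B.ᗮ-swapʳ p)
                             , (λ q → B.ᗮ-swapʳ (proj₂ q)) }
    }
    where
      module A = OML X₁
      module B = OML X₂

-- A morphism f : X → Y of OMLatGal is an antitone Galois connection
-- (f₊, f⁺), so its upper part f⁺ determines its lower part f₊ (hom-ext⁺).
--
--   * κᵢ† ∘ κᵢ = id and κⱼ† ∘ κᵢ = 0 reduce to involutivity of ᗮ.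
--   * Coproduct: the copairing [f₁ , f₂] has upper part y ↦ (f₁⁺ y , f₂⁺ y)
--     and lower part (a , b) ↦ f₁₊ a ∧ f₂₊ b.  Precomposing any h with κᵢ
--     reads off the i-th component of h⁺, so both the equations h ∘ κᵢ = fᵢ
--     and uniqueness of h follow by comparing upper parts.
--   * Product: the dagger is a strict involution reversing composition, so
--     the daggers of any coproduct cocone form a product cone.
module Submission where

open import Defs
open import Level using (Level)
open import Data.Product using (_×_; _,_; proj₁; proj₂)
open import Relation.Binary.PropositionalEquality
  using (_≡_; cong; cong₂; sym; trans; subst)

module _ {c ℓ : Level} where

  -- A Galois connection is determined by its upper part: f₊ x is the
  -- greatest y with x ≤ f⁺ y, so equal upper parts give equal morphisms.
  hom-ext⁺ : {X Y : OML c ℓ} (f g : Hom X Y) → (∀ y → f⁺ f y ≡ f⁺ g y) → f ≈ₕ g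
  hom-ext⁺ {X} {Y} f g e = lower-eq , e
    where
      module X = OML X
      module Y = OML Y
      below : ∀ x y → x X.≤ f⁺ f y → y Y.≤ f₊ g x
      below x y p = proj₁ (galois g x y) (subst (x X.≤_) (e y) p)
      above : ∀ x y → x X.≤ f⁺ g y → y Y.≤ f₊ f x
      above x y p = proj₁ (galois f x y) (subst (x X.≤_) (sym (e y)) p)
      lower-eq : ∀ x → f₊ f x ≡ f₊ g x
      lower-eq x = Y.antisym
        (below x (f₊ f x) (proj₂ (galois f x (f₊ f x)) Y.refl))
        (above x (f₊ g x) (proj₂ (galois g x (f₊ g x)) Y.refl))

  -- The dagger respects equality of morphisms.  (The morphisms are explicit
  -- because _≈ₕ_ is a defined relation from which they cannot be inferred.)
  †-cong : {X Y : OML c ℓ} (f g : Hom X Y) → f ≈ₕ g → f † ≈ₕ g †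
  †-cong f g (e₊ , e⁺) = e⁺ , e₊

  -- Daggers of a coproduct cocone form a product cone.  This uses only that
  -- † is involutive and reverses composition, both of which hold
  -- definitionally for Galois morphisms.
  coproduct⇒product† : {X₁ X₂ P : OML c ℓ} {i₁ : Hom X₁ P} {i₂ : Hom X₂ P} →
    IsCoproduct i₁ i₂ → IsProduct (i₁ †) (i₂ †)
  coproduct⇒product† {i₁ = i₁} {i₂} coprod Y f₁ f₂
    with coprod Y (f₁ †) (f₂ †)
  ... | h , h-i₁ , h-i₂ , unique =
      h †
    , †-cong (h ∘ₕ i₁) (f₁ †) h-i₁
    , †-cong (h ∘ₕ i₂) (f₂ †) h-i₂
    , λ h′ d₁ d₂ → †-cong (h′ †) h
        (unique (h′ †) (†-cong (i₁ † ∘ₕ h′) f₁ d₁) (†-cong (i₂ † ∘ₕ h′) f₂ d₂))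

  module DirectSum (X₁ X₂ : OML c ℓ) where
    private
      module A = OML X₁
      module B = OML X₂

    ι₁ : Hom X₁ (X₁ ⊕ X₂)
    ι₁ = κ₁

    ι₂ : Hom X₂ (X₁ ⊕ X₂)
    ι₂ = κ₂

    -- κ₁ and κ₂ are dagger monos: κᵢ† ∘ κᵢ is x ↦ xᗮᗮᗮ in both components.
    κ₁-daggerMono : IsDaggerMono ι₁
    κ₁-daggerMono = triple , triple
      where
        triple : ∀ x → ((x A.ᗮ) A.ᗮ) A.ᗮ ≡ x A.ᗮ
        triple x = cong A._ᗮ (A.ᗮ-involutive x)

    κ₂-daggerMono : IsDaggerMono ι₂
    κ₂-daggerMono = triple , triple
      where
        triple : ∀ y → ((y B.ᗮ) B.ᗮ) B.ᗮ ≡ y B.ᗮ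
        triple y = cong B._ᗮ (B.ᗮ-involutive y)

    -- The coprojections are orthogonal: κⱼ† ∘ κᵢ is constantly ⊤ᗮᗮ = ⊤.
    κ₂†∘κ₁-zero : ι₂ † ∘ₕ ι₁ ≈ₕ zeroₕ
    κ₂†∘κ₁-zero = (λ _ → B.ᗮ-involutive B.⊤) , (λ _ → A.ᗮ-involutive A.⊤)

    κ₁†∘κ₂-zero : ι₁ † ∘ₕ ι₂ ≈ₕ zeroₕ
    κ₁†∘κ₂-zero = (λ _ → A.ᗮ-involutive A.⊤) , (λ _ → B.ᗮ-involutive B.⊤)

    restrict₁⁺ : {Y : OML c ℓ} (h : Hom (X₁ ⊕ X₂) Y) →
      ∀ y → f⁺ (h ∘ₕ ι₁) y ≡ proj₁ (f⁺ h y)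
    restrict₁⁺ h y = A.ᗮ-involutive _

    restrict₂⁺ : {Y : OML c ℓ} (h : Hom (X₁ ⊕ X₂) Y) →
      ∀ y → f⁺ (h ∘ₕ ι₂) y ≡ proj₂ (f⁺ h y)
    restrict₂⁺ h y = B.ᗮ-involutive _

    module _ {Y : OML c ℓ} (f₁ : Hom X₁ Y) (f₂ : Hom X₂ Y) where
      private module Y = OML Y

      copair : Hom (X₁ ⊕ X₂) Y
      copair = record
        { f₊ = λ p → f₊ f₁ (proj₁ p) Y.∧ f₊ f₂ (proj₂ p)
        ; f⁺ = λ y → f⁺ f₁ y , f⁺ f₂ y
        ; f₊-antitone = λ p → Y.∧-greatest
            (Y.trans (Y.x∧y≤x _ _) (f₊-antitone f₁ (proj₁ p)))
            (Y.trans (Y.x∧y≤y _ _) (f₊-antitone f₂ (proj₂ p)))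
        ; f⁺-antitone = λ p → f⁺-antitone f₁ p , f⁺-antitone f₂ p
        ; galois = λ { (a , b) y →
            (λ q → Y.∧-greatest (proj₁ (galois f₁ a y) (proj₁ q))
                                (proj₁ (galois f₂ b y) (proj₂ q)))
          , (λ q → proj₂ (galois f₁ a y) (Y.trans q (Y.x∧y≤x _ _))
                 , proj₂ (galois f₂ b y) (Y.trans q (Y.x∧y≤y _ _))) }
        }

      copair-κ₁ : copair ∘ₕ ι₁ ≈ₕ f₁
      copair-κ₁ = hom-ext⁺ (copair ∘ₕ ι₁) f₁ (restrict₁⁺ copair)

      copair-κ₂ : copair ∘ₕ ι₂ ≈ₕ f₂
      copair-κ₂ = hom-ext⁺ (copair ∘ₕ ι₂) f₂ (restrict₂⁺ copair)

      copair-unique : ∀ (h : Hom (X₁ ⊕ X₂) Y) →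
        h ∘ₕ ι₁ ≈ₕ f₁ → h ∘ₕ ι₂ ≈ₕ f₂ → h ≈ₕ copair
      copair-unique h (_ , h₁⁺) (_ , h₂⁺) = hom-ext⁺ h copair upper-eq
        where
          upper-eq : ∀ y → f⁺ h y ≡ f⁺ copair y
          upper-eq y = cong₂ _,_ (trans (sym (restrict₁⁺ h y)) (h₁⁺ y))
                                 (trans (sym (restrict₂⁺ h y)) (h₂⁺ y))

    isCoproduct : IsCoproduct ι₁ ι₂
    isCoproduct Y f₁ f₂ =
      copair f₁ f₂ , copair-κ₁ f₁ f₂ , copair-κ₂ f₁ f₂ , copair-unique f₁ f₂

proposition3p12 : {c ℓ : Level} (X₁ X₂ : OML c ℓ) →
    IsDaggerMono (κ₁ {X₁ = X₁} {X₂ = X₂}) ×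
    IsDaggerMono (κ₂ {X₁ = X₁} {X₂ = X₂}) ×
    ((κ₂ {X₁ = X₁} {X₂ = X₂}) † ∘ₕ κ₁ ≈ₕ zeroₕ) ×
    ((κ₁ {X₁ = X₁} {X₂ = X₂}) † ∘ₕ κ₂ ≈ₕ zeroₕ) ×
    IsCoproduct (κ₁ {X₁ = X₁} {X₂ = X₂}) κ₂ ×
    IsProduct ((κ₁ {X₁ = X₁} {X₂ = X₂}) †) (κ₂ †)
proposition3p12 X₁ X₂ =
    κ₁-daggerMono
  , κ₂-daggerMono
  , κ₂†∘κ₁-zero
  , κ₁†∘κ₂-zero
  , isCoproduct
  , coproduct⇒product† {i₁ = ι₁} {i₂ = ι₂} isCoproduct
  where open DirectSum X₁ X₂
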